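{- Let $A$ be an abelian $2$-group and let $B$ be a group containing $A$ as a subgroup of index $2$. If $B$ is generated by elements of order $2$, then $A = \Omega(A)\, S$, where $\Omega(A) = \{x \in A : x^2 = 1\}$ and $S$ is the subgroup of $A$ consisting of those elements $x \in A$ that are inverted by an element of $B \setminus A$, i.e. for which $g^{ -1} x g = x^{ -1}$ for some $g \in B \setminus A$. -}

module Defs where

open import Level using (Level; _⊔_; suc)
open import Algebra.Bundles using (Group)
open import Data.Nat using (ℕ; zero; suc) renaming (_^_ to _^ℕ_)
open import Data.Product using (Σ; ∃; _×_; _,_)
open import Data.Sum using (_⊎_)
open import Relation.Nullary using (¬_)
open import Relation.Unary using (Pred; _∈_)

module GroupDefs {c ℓ : Level} (G : Group c ℓ) where
  open Group G

  _^_ : Carrier → ℕ → Carrier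
  x ^ zero  = ε
  x ^ suc n = x ∙ (x ^ n)

  record IsSubgroup {ℓA : Level} (A : Pred Carrier ℓA) : Set (c ⊔ ℓ ⊔ ℓA) where
    field
      resp  : ∀ {x y} → x ≈ y → A x → A y
      ε∈    : A ε
      ∙-closed : ∀ {x y} → A x → A y → A (x ∙ y)
      ⁻¹-closed : ∀ {x} → A x → A (x ⁻¹)

  IsAbelianSub : {ℓA : Level} → Pred Carrier ℓA → Set (c ⊔ ℓ ⊔ ℓA)
  IsAbelianSub A = ∀ {x y} → A x → A y → (x ∙ y) ≈ (y ∙ x)

  Is2Group : {ℓA : Level} → Pred Carrier ℓA → Set (c ⊔ ℓ ⊔ ℓA)
  Is2Group A = ∀ {x} → A x → ∃ λ k → (x ^ (2 ^ℕ k)) ≈ ε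

  HasIndex2 : {ℓA : Level} → Pred Carrier ℓA → Set (c ⊔ ℓA)
  HasIndex2 A = Σ Carrier λ t → (¬ A t) × (∀ x → A x ⊎ A ((t ⁻¹) ∙ x))

  HasOrder2 : Carrier → Set ℓ
  HasOrder2 x = ((x ∙ x) ≈ ε) × (¬ (x ≈ ε))

  data Generated {ℓP : Level} (P : Pred Carrier ℓP) : Carrier → Set (c ⊔ ℓ ⊔ ℓP) where
    gen  : ∀ {x} → P x → Generated P x
    unit : Generated P ε
    mul  : ∀ {x y} → Generated P x → Generated P y → Generated P (x ∙ y)
    inv  : ∀ {x} → Generated P x → Generated P (x ⁻¹)
    resp : ∀ {x y} → x ≈ y → Generated P x → Generated P y

  Ω : {ℓA : Level} → Pred Carrier ℓA → Pred Carrier (ℓ ⊔ ℓA)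
  Ω A x = A x × ((x ∙ x) ≈ ε)

  InvertedPart : {ℓA : Level} → Pred Carrier ℓA → Pred Carrier (c ⊔ ℓ ⊔ ℓA)
  InvertedPart A x = A x × (Σ Carrier λ g → (¬ A g) × (((g ⁻¹) ∙ x) ∙ g) ≈ (x ⁻¹))

{-# OPTIONS --safe #-}
-- Since B is generated by involutions and A ≠ B, some involution u lies outside A.
-- Conjugation by u normalises A, so H = Ω(A)·S_u, where S_u is the set of elements of A
-- inverted by u, is a u-stable subgroup of A, and H ∪ uH is a subgroup of B. It contains
-- every involution x: either x ∈ Ω(A), or x = u(ux) with ux ∈ A inverted by u. Hence
-- H ∪ uH = B, and as uH ∩ A = ∅ we get A ⊆ H.
module Submission where

open import Defs
open import Level using (Level; _⊔_)
open import Algebra.Bundles using (Group)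
open import Data.Product using (Σ; _×_; _,_; proj₁; proj₂)
open import Data.Sum using (_⊎_; inj₁; inj₂; fromInj₂)
open import Data.Empty using (⊥-elim)
open import Function using (_∘_)
open import Relation.Nullary using (¬_)
open import Relation.Unary using (Pred; _⊆_)
import Algebra.Properties.Group as GroupProperties
import Algebra.Solver.Monoid as MonoidSolver
import Relation.Binary.Reasoning.Setoid as SetoidReasoning

module GroupTheory {c ℓ : Level} (G : Group c ℓ) where
  open Group G
  open GroupDefs G
  open GroupProperties G
  open SetoidReasoning setoid
  open MonoidSolver monoid using (solve; _⊕_; _⊜_)

  swap-middle : ∀ a b c d → b ∙ c ≈ c ∙ b → a ∙ b ∙ (c ∙ d) ≈ a ∙ c ∙ (b ∙ d)
  swap-middle a b c d bc≈cb = begin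
    a ∙ b ∙ (c ∙ d)
      ≈⟨ solve 4 (λ a b c d → (a ⊕ b) ⊕ (c ⊕ d) ⊜ a ⊕ ((b ⊕ c) ⊕ d)) refl a b c d ⟩
    a ∙ (b ∙ c ∙ d)
      ≈⟨ ∙-congˡ (∙-congʳ bc≈cb) ⟩
    a ∙ (c ∙ b ∙ d)
      ≈⟨ solve 4 (λ a b c d → a ⊕ ((c ⊕ b) ⊕ d) ⊜ (a ⊕ c) ⊕ (b ⊕ d)) refl a b c d ⟩
    a ∙ c ∙ (b ∙ d) ∎

  involution⇒self-inverse : ∀ {x} → x ∙ x ≈ ε → x ≈ x ⁻¹
  involution⇒self-inverse {x} = inverseˡ-unique x x

  generated-minimal : ∀ {ℓP ℓH} {P : Pred Carrier ℓP} {H : Pred Carrier ℓH} →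
                      IsSubgroup H → P ⊆ H → Generated P ⊆ H
  generated-minimal {P = P} {H} H-sub P⊆H = go
    where
    module H = IsSubgroup H-sub

    go : Generated P ⊆ H
    go (gen x∈P)    = P⊆H x∈P
    go unit         = H.ε∈
    go (mul x y)    = H.∙-closed (go x) (go y)
    go (inv x)      = H.⁻¹-closed (go x)
    go (resp x≈y x) = H.resp x≈y (go x)

  conj : Carrier → Carrier → Carrier
  conj g x = g ⁻¹ ∙ x ∙ g

  conj-cong : ∀ g {x y} → x ≈ y → conj g x ≈ conj g y
  conj-cong g x≈y = ∙-congʳ (∙-congˡ x≈y)

  conj-homo : ∀ g x y → conj g (x ∙ y) ≈ conj g x ∙ conj g y
  conj-homo g x y = sym (begin
    g ⁻¹ ∙ x ∙ g ∙ (g ⁻¹ ∙ y ∙ g)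
      ≈⟨ solve 4 (λ h x g y → ((h ⊕ x) ⊕ g) ⊕ ((h ⊕ y) ⊕ g) ⊜ ((h ⊕ x) ⊕ (g ⊕ (h ⊕ y))) ⊕ g)
               refl (g ⁻¹) x g y ⟩
    g ⁻¹ ∙ x ∙ (g ∙ (g ⁻¹ ∙ y)) ∙ g
      ≈⟨ ∙-congʳ (∙-congˡ (\\-leftDividesˡ g y)) ⟩
    g ⁻¹ ∙ x ∙ y ∙ g
      ≈⟨ ∙-congʳ (assoc (g ⁻¹) x y) ⟩
    g ⁻¹ ∙ (x ∙ y) ∙ g ∎)

  conj-ε : ∀ g → conj g ε ≈ ε
  conj-ε g = trans (∙-congʳ (identityʳ (g ⁻¹))) (inverseˡ g)

  conj-⁻¹ : ∀ g x → conj g (x ⁻¹) ≈ conj g x ⁻¹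
  conj-⁻¹ g x = inverseˡ-unique (conj g (x ⁻¹)) (conj g x) (begin
    conj g (x ⁻¹) ∙ conj g x ≈⟨ conj-homo g (x ⁻¹) x ⟨
    conj g (x ⁻¹ ∙ x)        ≈⟨ conj-cong g (inverseˡ x) ⟩
    conj g ε                 ≈⟨ conj-ε g ⟩
    ε                        ∎)

  involutions⇒product-inverted : ∀ {u x} → u ∙ u ≈ ε → x ∙ x ≈ ε →
                                 conj u (u ∙ x) ≈ (u ∙ x) ⁻¹
  involutions⇒product-inverted {u} {x} u²≈ε x²≈ε = begin
    u ⁻¹ ∙ (u ∙ x) ∙ u ≈⟨ ∙-congʳ (\\-leftDividesʳ u x) ⟩
    x ∙ u              ≈⟨ ∙-cong (involution⇒self-inverse x²≈ε) (involution⇒self-inverse u²≈ε) ⟩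
    x ⁻¹ ∙ u ⁻¹        ≈⟨ ⁻¹-anti-homo-∙ u x ⟨
    (u ∙ x) ⁻¹         ∎

  ConjClosed : ∀ {ℓH} → Carrier → Pred Carrier ℓH → Set (c ⊔ ℓH)
  ConjClosed g H = ∀ {x} → H x → H (conj g x)

  InvertedBy : ∀ {ℓA} → Pred Carrier ℓA → Carrier → Pred Carrier (ℓ ⊔ ℓA)
  InvertedBy A g x = A x × conj g x ≈ x ⁻¹

  _·_ : ∀ {ℓP ℓQ} → Pred Carrier ℓP → Pred Carrier ℓQ → Pred Carrier (c ⊔ ℓ ⊔ ℓP ⊔ ℓQ)
  (P · Q) x = Σ Carrier λ p → Σ Carrier λ q → P p × Q q × x ≈ p ∙ q

  ·-introˡ : ∀ {ℓP ℓQ} {P : Pred Carrier ℓP} {Q : Pred Carrier ℓQ} → Q ε → P ⊆ P · Q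
  ·-introˡ ε∈Q {x} x∈P = x , ε , x∈P , ε∈Q , sym (identityʳ x)

  ·-introʳ : ∀ {ℓP ℓQ} {P : Pred Carrier ℓP} {Q : Pred Carrier ℓQ} → P ε → Q ⊆ P · Q
  ·-introʳ ε∈P {x} x∈Q = ε , x , ε∈P , x∈Q , sym (identityˡ x)

  ·-isSubgroup : ∀ {ℓP ℓQ} {P : Pred Carrier ℓP} {Q : Pred Carrier ℓQ} →
                 IsSubgroup P → IsSubgroup Q → (∀ {p q} → P p → Q q → p ∙ q ≈ q ∙ p) →
                 IsSubgroup (P · Q)
  ·-isSubgroup P-sub Q-sub commute = record
    { resp      = λ x≈y (p , q , p∈P , q∈Q , x≈pq) → p , q , p∈P , q∈Q , trans (sym x≈y) x≈pq
    ; ε∈        = ε , ε , P.ε∈ , Q.ε∈ , sym (identityˡ ε)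
    ; ∙-closed  = λ (p , q , p∈P , q∈Q , x≈pq) (p′ , q′ , p′∈P , q′∈Q , y≈p′q′) →
        p ∙ p′ , q ∙ q′ , P.∙-closed p∈P p′∈P , Q.∙-closed q∈Q q′∈Q ,
        trans (∙-cong x≈pq y≈p′q′) (swap-middle p q p′ q′ (sym (commute p′∈P q∈Q)))
    ; ⁻¹-closed = λ (p , q , p∈P , q∈Q , x≈pq) →
        p ⁻¹ , q ⁻¹ , P.⁻¹-closed p∈P , Q.⁻¹-closed q∈Q ,
        trans (⁻¹-cong x≈pq)
          (trans (⁻¹-anti-homo-∙ p q) (sym (commute (P.⁻¹-closed p∈P) (Q.⁻¹-closed q∈Q))))
    }
    where
    module P = IsSubgroup P-sub
    module Q = IsSubgroup Q-sub

  ·-conjClosed : ∀ {ℓP ℓQ} {P : Pred Carrier ℓP} {Q : Pred Carrier ℓQ} {g} →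
                 ConjClosed g P → ConjClosed g Q → ConjClosed g (P · Q)
  ·-conjClosed {g = g} P-closed Q-closed (p , q , p∈P , q∈Q , x≈pq) =
    conj g p , conj g q , P-closed p∈P , Q-closed q∈Q ,
    trans (conj-cong g x≈pq) (conj-homo g p q)

  Ω-conjClosed : ∀ {ℓA} {A : Pred Carrier ℓA} {g} → ConjClosed g A → ConjClosed g (Ω A)
  Ω-conjClosed {g = g} A-closed {x} (x∈A , x²≈ε) =
    A-closed x∈A , trans (sym (conj-homo g x x)) (trans (conj-cong g x²≈ε) (conj-ε g))

  module _ {ℓA} {A : Pred Carrier ℓA} (A-sub : IsSubgroup A) (A-abelian : IsAbelianSub A) where
    private module A = IsSubgroup A-sub

    Ω-isSubgroup : IsSubgroup (Ω A)
    Ω-isSubgroup = record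
      { resp      = λ x≈y (x∈A , x²≈ε) →
          A.resp x≈y x∈A , trans (∙-cong (sym x≈y) (sym x≈y)) x²≈ε
      ; ε∈        = A.ε∈ , identityˡ ε
      ; ∙-closed  = λ { {x} {y} (x∈A , x²≈ε) (y∈A , y²≈ε) →
          A.∙-closed x∈A y∈A ,
          trans (swap-middle x y x y (A-abelian y∈A x∈A))
                (trans (∙-cong x²≈ε y²≈ε) (identityˡ ε)) }
      ; ⁻¹-closed = λ { {x} (x∈A , x²≈ε) →
          A.⁻¹-closed x∈A , trans (sym (⁻¹-anti-homo-∙ x x)) (trans (⁻¹-cong x²≈ε) ε⁻¹≈ε) }
      }

    InvertedBy-isSubgroup : ∀ g → IsSubgroup (InvertedBy A g)
    InvertedBy-isSubgroup g = record
      { resp      = λ x≈y (x∈A , inv-x) →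
          A.resp x≈y x∈A , trans (conj-cong g (sym x≈y)) (trans inv-x (⁻¹-cong x≈y))
      ; ε∈        = A.ε∈ , trans (conj-ε g) (sym ε⁻¹≈ε)
      ; ∙-closed  = λ { {x} {y} (x∈A , inv-x) (y∈A , inv-y) →
          A.∙-closed x∈A y∈A , (begin
            conj g (x ∙ y)      ≈⟨ conj-homo g x y ⟩
            conj g x ∙ conj g y ≈⟨ ∙-cong inv-x inv-y ⟩
            x ⁻¹ ∙ y ⁻¹         ≈⟨ ⁻¹-anti-homo-∙ y x ⟨
            (y ∙ x) ⁻¹          ≈⟨ ⁻¹-cong (A-abelian y∈A x∈A) ⟩
            (x ∙ y) ⁻¹          ∎) }
      ; ⁻¹-closed = λ { {x} (x∈A , inv-x) →
          A.⁻¹-closed x∈A , trans (conj-⁻¹ g x) (⁻¹-cong inv-x) }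
      }

    InvertedBy-conjClosed : ∀ g → ConjClosed g (InvertedBy A g)
    InvertedBy-conjClosed g x∈S@(_ , inv-x) = S.resp (sym inv-x) (S.⁻¹-closed x∈S)
      where module S = IsSubgroup (InvertedBy-isSubgroup g)

  AdjoinInvolution : ∀ {ℓH} → Pred Carrier ℓH → Carrier → Pred Carrier ℓH
  AdjoinInvolution H u x = H x ⊎ H (u ∙ x)

  AdjoinInvolution-isSubgroup : ∀ {ℓH} {H : Pred Carrier ℓH} {u} → IsSubgroup H →
                                u ∙ u ≈ ε → ConjClosed u H → IsSubgroup (AdjoinInvolution H u)
  AdjoinInvolution-isSubgroup {H = H} {u} H-sub u²≈ε H-closed = record
    { resp      = λ { x≈y (inj₁ x∈H)  → inj₁ (H.resp x≈y x∈H)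
                    ; x≈y (inj₂ ux∈H) → inj₂ (H.resp (∙-congˡ x≈y) ux∈H) }
    ; ε∈        = inj₁ H.ε∈
    ; ∙-closed  = ∙-closed
    ; ⁻¹-closed = ⁻¹-closed
    }
    where
    module H = IsSubgroup H-sub

    u⁻¹≈u : u ⁻¹ ≈ u
    u⁻¹≈u = sym (involution⇒self-inverse u²≈ε)

    cancel-u² : ∀ a b → a ∙ u ∙ (u ∙ b) ≈ a ∙ b
    cancel-u² a b = begin
      a ∙ u ∙ (u ∙ b) ≈⟨ solve 3 (λ a u b → (a ⊕ u) ⊕ (u ⊕ b) ⊜ (a ⊕ (u ⊕ u)) ⊕ b) refl a u b ⟩
      a ∙ (u ∙ u) ∙ b ≈⟨ ∙-congʳ (trans (∙-congˡ u²≈ε) (identityʳ a)) ⟩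
      a ∙ b           ∎

    ∙-closed : ∀ {x y} → AdjoinInvolution H u x → AdjoinInvolution H u y →
               AdjoinInvolution H u (x ∙ y)
    ∙-closed (inj₁ x∈H) (inj₁ y∈H) = inj₁ (H.∙-closed x∈H y∈H)
    ∙-closed {x} {y} (inj₁ x∈H) (inj₂ uy∈H) = inj₂ (H.resp (begin
      u ⁻¹ ∙ x ∙ u ∙ (u ∙ y) ≈⟨ cancel-u² (u ⁻¹ ∙ x) y ⟩
      u ⁻¹ ∙ x ∙ y           ≈⟨ ∙-congʳ (∙-congʳ u⁻¹≈u) ⟩
      u ∙ x ∙ y              ≈⟨ assoc u x y ⟩
      u ∙ (x ∙ y)            ∎) (H.∙-closed (H-closed x∈H) uy∈H))
    ∙-closed {x} {y} (inj₂ ux∈H) (inj₁ y∈H) = inj₂ (H.resp (assoc u x y) (H.∙-closed ux∈H y∈H))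
    ∙-closed {x} {y} (inj₂ ux∈H) (inj₂ uy∈H) = inj₁ (H.resp (begin
      u ⁻¹ ∙ (u ∙ x) ∙ u ∙ (u ∙ y) ≈⟨ cancel-u² (u ⁻¹ ∙ (u ∙ x)) y ⟩
      u ⁻¹ ∙ (u ∙ x) ∙ y           ≈⟨ ∙-congʳ (\\-leftDividesʳ u x) ⟩
      x ∙ y                        ∎) (H.∙-closed (H-closed ux∈H) uy∈H))

    ⁻¹-closed : ∀ {x} → AdjoinInvolution H u x → AdjoinInvolution H u (x ⁻¹)
    ⁻¹-closed (inj₁ x∈H) = inj₁ (H.⁻¹-closed x∈H)
    ⁻¹-closed {x} (inj₂ ux∈H) = inj₂ (H.resp (begin
      u ⁻¹ ∙ (u ∙ x) ⁻¹ ∙ u     ≈⟨ conj-cong u (⁻¹-anti-homo-∙ u x) ⟩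
      u ⁻¹ ∙ (x ⁻¹ ∙ u ⁻¹) ∙ u  ≈⟨ ∙-congʳ (assoc (u ⁻¹) (x ⁻¹) (u ⁻¹)) ⟨
      u ⁻¹ ∙ x ⁻¹ ∙ u ⁻¹ ∙ u    ≈⟨ //-rightDividesˡ u (u ⁻¹ ∙ x ⁻¹) ⟩
      u ⁻¹ ∙ x ⁻¹               ≈⟨ ∙-congʳ u⁻¹≈u ⟩
      u ∙ x ⁻¹                  ∎) (H-closed (H.⁻¹-closed ux∈H)))

  module IndexTwo {ℓA} {A : Pred Carrier ℓA} (A-sub : IsSubgroup A) (A-index2 : HasIndex2 A) where
    private
      module A = IsSubgroup A-sub

      t : Carrier
      t = proj₁ A-index2

      t∉A : ¬ A t
      t∉A = proj₁ (proj₂ A-index2)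

      ∈A⊎∈tA : ∀ x → A x ⊎ A (t ⁻¹ ∙ x)
      ∈A⊎∈tA = proj₂ (proj₂ A-index2)

    ∉⇒⁻¹∉ : ∀ {x} → ¬ A x → ¬ A (x ⁻¹)
    ∉⇒⁻¹∉ {x} x∉A x⁻¹∈A = x∉A (A.resp (⁻¹-involutive x) (A.⁻¹-closed x⁻¹∈A))

    ∉∙∈⇒∉ : ∀ {x y} → ¬ A x → A y → ¬ A (x ∙ y)
    ∉∙∈⇒∉ {x} {y} x∉A y∈A xy∈A =
      x∉A (A.resp (//-rightDividesʳ y x) (A.∙-closed xy∈A (A.⁻¹-closed y∈A)))

    ∈-dec : ∀ x → A x ⊎ ¬ A x
    ∈-dec x with ∈A⊎∈tA x
    ... | inj₁ x∈A    = inj₁ x∈A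
    ... | inj₂ t⁻¹x∈A = inj₂ λ x∈A → ∉∙∈⇒∉ (∉⇒⁻¹∉ t∉A) x∈A t⁻¹x∈A

    ∉⇒∈tA : ∀ {x} → ¬ A x → A (t ⁻¹ ∙ x)
    ∉⇒∈tA {x} x∉A with ∈A⊎∈tA x
    ... | inj₁ x∈A    = ⊥-elim (x∉A x∈A)
    ... | inj₂ t⁻¹x∈A = t⁻¹x∈A

    ∉∙∉⇒∈ : ∀ {x y} → ¬ A x → ¬ A y → A (x ∙ y)
    ∉∙∉⇒∈ {x} {y} x∉A y∉A =
      A.resp (begin
        (t ⁻¹ ∙ x ⁻¹) ⁻¹ ∙ (t ⁻¹ ∙ y)
          ≈⟨ ∙-congʳ (⁻¹-anti-homo-∙ (t ⁻¹) (x ⁻¹)) ⟩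
        x ⁻¹ ⁻¹ ∙ t ⁻¹ ⁻¹ ∙ (t ⁻¹ ∙ y)
          ≈⟨ assoc (x ⁻¹ ⁻¹) (t ⁻¹ ⁻¹) (t ⁻¹ ∙ y) ⟩
        x ⁻¹ ⁻¹ ∙ (t ⁻¹ ⁻¹ ∙ (t ⁻¹ ∙ y))
          ≈⟨ ∙-cong (⁻¹-involutive x) (\\-leftDividesʳ (t ⁻¹) y) ⟩
        x ∙ y ∎)
      (A.∙-closed (A.⁻¹-closed (∉⇒∈tA (∉⇒⁻¹∉ x∉A))) (∉⇒∈tA y∉A))

    normal : ∀ g → ConjClosed g A
    normal g x∈A with ∈-dec g
    ... | inj₁ g∈A = A.∙-closed (A.∙-closed (A.⁻¹-closed g∈A) x∈A) g∈A
    ... | inj₂ g∉A = ∉∙∉⇒∈ (∉∙∈⇒∉ (∉⇒⁻¹∉ g∉A) x∈A) g∉A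

    -- A x ⊎ E is a subgroup containing the generators; at t ∉ A it must produce E.
    generator-∉ : ∀ {ℓP} {P : Pred Carrier ℓP} → (∀ x → Generated P x) →
                  Σ Carrier λ u → P u × ¬ A u
    generator-∉ {P = P} generated =
      fromInj₂ (⊥-elim ∘ t∉A) (generated-minimal A⊎E-isSubgroup P⊆A⊎E (generated t))
      where
      E : Set _
      E = Σ Carrier λ u → P u × ¬ A u

      A⊎E-isSubgroup : IsSubgroup (λ x → A x ⊎ E)
      A⊎E-isSubgroup = record
        { resp      = λ { x≈y (inj₁ x∈A) → inj₁ (A.resp x≈y x∈A) ; _ (inj₂ e) → inj₂ e }
        ; ε∈        = inj₁ A.ε∈
        ; ∙-closed  = λ { (inj₁ x∈A) (inj₁ y∈A) → inj₁ (A.∙-closed x∈A y∈A)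
                        ; (inj₂ e) _ → inj₂ e
                        ; _ (inj₂ e) → inj₂ e }
        ; ⁻¹-closed = λ { (inj₁ x∈A) → inj₁ (A.⁻¹-closed x∈A) ; (inj₂ e) → inj₂ e }
        }

      P⊆A⊎E : P ⊆ λ x → A x ⊎ E
      P⊆A⊎E {x} x∈P with ∈-dec x
      ... | inj₁ x∈A = inj₁ x∈A
      ... | inj₂ x∉A = inj₂ (x , x∈P , x∉A)

    module _ (A-abelian : IsAbelianSub A) {u} (u²≈ε : u ∙ u ≈ ε) (u∉A : ¬ A u) where
      private
        H : Pred Carrier _
        H = Ω A · InvertedBy A u

        H-isSubgroup : IsSubgroup H
        H-isSubgroup = ·-isSubgroup (Ω-isSubgroup A-sub A-abelian)
                                    (InvertedBy-isSubgroup A-sub A-abelian u)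
                                    (λ (w∈A , _) (s∈A , _) → A-abelian w∈A s∈A)

        H-conjClosed : ConjClosed u H
        H-conjClosed = ·-conjClosed (Ω-conjClosed {A = A} (normal u))
                                    (InvertedBy-conjClosed A-sub A-abelian u)

        H⊆A : H ⊆ A
        H⊆A (w , s , (w∈A , _) , (s∈A , _) , x≈ws) = A.resp (sym x≈ws) (A.∙-closed w∈A s∈A)

        involution∈H∪uH : HasOrder2 ⊆ AdjoinInvolution H u
        involution∈H∪uH {x} (x²≈ε , _) with ∈-dec x
        ... | inj₁ x∈A = inj₁ (·-introˡ (IsSubgroup.ε∈ (InvertedBy-isSubgroup A-sub A-abelian u))
                                        (x∈A , x²≈ε))
        ... | inj₂ x∉A = inj₂ (·-introʳ (IsSubgroup.ε∈ (Ω-isSubgroup A-sub A-abelian))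
                                        (∉∙∉⇒∈ u∉A x∉A , involutions⇒product-inverted u²≈ε x²≈ε))

      A⊆Ω·InvertedBy : (∀ x → Generated HasOrder2 x) → A ⊆ Ω A · InvertedBy A u
      A⊆Ω·InvertedBy generated {a} a∈A
        with generated-minimal (AdjoinInvolution-isSubgroup H-isSubgroup u²≈ε H-conjClosed)
                               involution∈H∪uH (generated a)
      ... | inj₁ a∈H  = a∈H
      ... | inj₂ ua∈H = ⊥-elim (∉∙∈⇒∉ u∉A a∈A (H⊆A ua∈H))

lemma5 : {c ℓ ℓA : Level} (B : Group c ℓ) (A : Pred (Group.Carrier B) ℓA) →
    let open Group B
        open GroupDefs B
    in
    IsSubgroup A → IsAbelianSub A → Is2Group A → HasIndex2 A →
    (∀ x → Generated HasOrder2 x) →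
    ∀ a → A a → Σ Carrier λ w → Σ Carrier λ s → Ω A w × InvertedPart A s × (a ≈ (w ∙ s))
lemma5 B A A-sub A-abelian _ A-index2 generated a a∈A =
  let u , (u²≈ε , _) , u∉A = generator-∉ generated
      w , s , w∈Ω , (s∈A , u-inverts-s) , a≈ws =
        A⊆Ω·InvertedBy A-abelian u²≈ε u∉A generated a∈A
  in  w , s , w∈Ω , (s∈A , u , u∉A , u-inverts-s) , a≈ws
  where
  open GroupTheory B
  open IndexTwo A-sub A-index2
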